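{- Let $\Gamma,\Delta$ be finite subsets of $For_2$ with $\Gamma\cup\Delta$ nonempty. If $\Gamma\Rightarrow\Delta$ is provable in the sequent calculus $\mathbf{B}$, then $\vDash_{\mathbf{B}_3}\Gamma\Rightarrow\Delta$. In particular, if $\Gamma\Rightarrow\alpha$ is provable in $\mathbf{B}$ then $\Gamma\vDash_{\mathbf{B}_3}\alpha$.
   Context: Fix a denumerable set $prop$ of propositional variables. $For_2$ is the set of formulas built from $prop$ with a unary connective $\lnot$ and a binary connective $\wedge$. $var(\alpha)$ is the set of propositional variables in $\alpha$; $var(\Gamma)=\bigcup_{\gamma\in\Gamma}var(\gamma)$. A sequent $\Gamma\Rightarrow\Delta$ is an ordered pair of finite sets of formulas, not both empty; $\alpha,\Gamma$ denotes $\Gamma\cup\{\alpha\}$. The calculus $\mathbf{B}$ has the axiom $\alpha\Rightarrow\alpha$ and the rules (premises / conclusion): (W$\Rightarrow$) $\Gamma\Rightarrow\Delta$ / $\alpha,\Gamma\Rightarrow\Delta$; ($\Rightarrow$W) $\Gamma\Rightarrow\Delta$ / $\Gamma\Rightarrow\Delta,\alpha$; (Cut) $\Gamma\Rightarrow\Delta,\alpha$ and $\alpha,\Gamma\Rightarrow\Delta$ / $\Gamma\Rightarrow\Delta$; ($\lnot\Rightarrow$) $\Gamma\Rightarrow\Delta,\alpha$ / $\lnot\alpha,\Gamma\Rightarrow\Delta$; ($\Rightarrow\lnot^B$) $\alpha,\Gamma\Rightarrow\Delta$ / $\Gamma\Rightarrow\Delta,\lnot\alpha$, allowed only if $var(\alpha)\subseteq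 var(\Gamma)$; ($\wedge\Rightarrow$) $\alpha_1,\alpha_2,\Gamma\Rightarrow\Delta$ / $\alpha_1\wedge\alpha_2,\Gamma\Rightarrow\Delta$; ($\Rightarrow\wedge$) $\Gamma\Rightarrow\Delta,\alpha_1$ and $\Gamma\Rightarrow\Delta,\alpha_2$ / $\Gamma\Rightarrow\Delta,\alpha_1\wedge\alpha_2$. Bochvar's logic $\mathbf{B}_3$ on $For_2$: truth values $\{1,\tfrac12,0\}$ with designated set $\{1\}$; valuations map $prop$ to $\{1,\tfrac12,0\}$ and extend by $\lnot1=0,\lnot\tfrac12=\tfrac12,\lnot0=1$, and $x\wedge y=\tfrac12$ if $x=\tfrac12$ or $y=\tfrac12$, otherwise classical conjunction. $\vDash_{\mathbf{B}_3}\Gamma\Rightarrow\Delta$ means: for every valuation $v$, if $v(\gamma)=1$ for all $\gamma\in\Gamma$ then $v(\delta)=1$ for some $\delta\in\Delta$. $\Gamma\vDash_{\mathbf{B}_3}\alpha$ means every valuation giving value $1$ to all of $\Gamma$ gives value $1$ to $\alpha$. -}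

module Defs where

open import Data.Nat using (ℕ)
open import Data.List using (List; []; _∷_)
open import Data.List.Membership.Propositional using (_∈_)
open import Data.List.Relation.Unary.Any using (Any)
open import Data.List.Relation.Unary.All using (All)
open import Data.Product using (_×_; ∃-syntax)
open import Data.Sum using (_⊎_)
open import Relation.Binary.PropositionalEquality using (_≡_)

Prop : Set
Prop = ℕ

data Form : Set where
  var  : Prop → Form
  ¬'_  : Form → Form
  _∧'_ : Form → Form → Form

data Occurs (p : Prop) : Form → Set where
  here : Occurs p (var p)
  neg  : ∀ {a} → Occurs p a → Occurs p (¬' a)
  conjˡ : ∀ {a b} → Occurs p a → Occurs p (a ∧' b)
  conjʳ : ∀ {a b} → Occurs p b → Occurs p (a ∧' b)

VarsIn : Form → List Form → Set
VarsIn a Γ = ∀ p → Occurs p a → ∃[ g ] (g ∈ Γ × Occurs p g)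

-- finite sets of formulas are represented by lists, identified up to
-- having the same members; α,Γ is  α ∷ Γ  and  Δ,α  is  α ∷ Δ.
SameSet : List Form → List Form → Set
SameSet Γ Γ' = ∀ a → (a ∈ Γ → a ∈ Γ') × (a ∈ Γ' → a ∈ Γ)

data ⊢B : List Form → List Form → Set where
  ax    : ∀ a → ⊢B (a ∷ []) (a ∷ [])
  -- sequents are pairs of sets: list representations with the same
  -- members denote the same sequent
  set   : ∀ {Γ Δ Γ' Δ'} → SameSet Γ Γ' → SameSet Δ Δ' → ⊢B Γ Δ → ⊢B Γ' Δ'
  wL    : ∀ {Γ Δ} a → ⊢B Γ Δ → ⊢B (a ∷ Γ) Δ
  wR    : ∀ {Γ Δ} a → ⊢B Γ Δ → ⊢B Γ (a ∷ Δ)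
  cut   : ∀ {Γ Δ} a → ⊢B Γ (a ∷ Δ) → ⊢B (a ∷ Γ) Δ → ⊢B Γ Δ
  negL  : ∀ {Γ Δ a} → ⊢B Γ (a ∷ Δ) → ⊢B (¬' a ∷ Γ) Δ
  negRB : ∀ {Γ Δ a} → VarsIn a Γ → ⊢B (a ∷ Γ) Δ → ⊢B Γ (¬' a ∷ Δ)
  conjL : ∀ {Γ Δ a b} → ⊢B (a ∷ b ∷ Γ) Δ → ⊢B ((a ∧' b) ∷ Γ) Δ
  conjR : ∀ {Γ Δ a b} → ⊢B Γ (a ∷ Δ) → ⊢B Γ (b ∷ Δ) → ⊢B Γ ((a ∧' b) ∷ Δ)

data V : Set where
  one half zero : V

notV : V → V
notV one  = zero
notV half = half
notV zero = one

andV : V → V → V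
andV half _    = half
andV _    half = half
andV one  one  = one
andV one  zero = zero
andV zero one  = zero
andV zero zero = zero

Valuation : Set
Valuation = Prop → V

eval : Valuation → Form → V
eval v (var p)  = v p
eval v (¬' a)   = notV (eval v a)
eval v (a ∧' b) = andV (eval v a) (eval v b)

⊨B3 : List Form → List Form → Set
⊨B3 Γ Δ = ∀ (v : Valuation) → All (λ g → eval v g ≡ one) Γ →
            Any (λ d → eval v d ≡ one) Δ

Conseq : List Form → Form → Set
Conseq Γ a = ∀ (v : Valuation) → All (λ g → eval v g ≡ one) Γ → eval v a ≡ one

NonEmptySeq : List Form → List Form → Set
NonEmptySeq Γ Δ = (∃[ a ] a ∈ Γ) ⊎ (∃[ a ] a ∈ Δ)

module Submission where

-- The right negation
-- rule is the delicate one: it is unsound in general, because α may take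
-- the value ½, making both α and ¬α undesignated.  The side condition
-- var(α) ⊆ var(Γ) repairs this through two facts about the tables:
--   * ½ is infectious: a variable with value ½ gives value ½ to every
--     formula it occurs in, so no such variable occurs in a true premise;
--   * a formula none of whose variables has value ½ takes a classical
--     value 1 or 0.
-- Hence when all of Γ is true, α is classical, and either α is true (use
-- the premise) or ¬α is true.

open import Defs
open import Data.List using (List; []; _∷_)
open import Data.List.Relation.Unary.Any using (Any; here; there)
open import Data.List.Relation.Unary.Any.Properties using (singleton⁻)
open import Data.List.Relation.Unary.All using (All; _∷_) renaming (lookup to All-lookup)
open import Data.List.Relation.Binary.Subset.Propositional.Properties using (Any-resp-⊆; All-resp-⊇)
open import Data.Product using (_×_; _,_; proj₁; ∃-syntax)
open import Data.Sum using (_⊎_; inj₁; inj₂)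
open import Data.Empty using (⊥-elim)
open import Relation.Nullary using (¬_)
open import Relation.Binary.PropositionalEquality using (_≡_; refl; sym; trans)

True : Valuation → Form → Set
True v a = eval v a ≡ one

Classical : V → Set
Classical x = x ≡ one ⊎ x ≡ zero

andV-true⁻ : ∀ x y → andV x y ≡ one → x ≡ one × y ≡ one
andV-true⁻ one  one  refl = refl , refl
andV-true⁻ one  zero ()
andV-true⁻ one  half ()
andV-true⁻ zero one  ()
andV-true⁻ zero zero ()
andV-true⁻ zero half ()
andV-true⁻ half _    ()

andV-true⁺ : ∀ {x y} → x ≡ one → y ≡ one → andV x y ≡ one
andV-true⁺ refl refl = refl

notV-true⁻ : ∀ x → notV x ≡ one → ¬ x ≡ one
notV-true⁻ one  () _
notV-true⁻ half () _
notV-true⁻ zero _  ()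

notV-true⁺ : ∀ {x} → x ≡ zero → notV x ≡ one
notV-true⁺ refl = refl

notV-classical : ∀ {x} → Classical x → Classical (notV x)
notV-classical (inj₁ refl) = inj₂ refl
notV-classical (inj₂ refl) = inj₁ refl

andV-classical : ∀ {x y} → Classical x → Classical y → Classical (andV x y)
andV-classical (inj₁ refl) (inj₁ refl) = inj₁ refl
andV-classical (inj₁ refl) (inj₂ refl) = inj₂ refl
andV-classical (inj₂ refl) (inj₁ refl) = inj₂ refl
andV-classical (inj₂ refl) (inj₂ refl) = inj₂ refl

andV-halfʳ : ∀ x → andV x half ≡ half
andV-halfʳ one  = refl
andV-halfʳ half = refl
andV-halfʳ zero = refl

half-infects : ∀ v {p} a → Occurs p a → v p ≡ half → eval v a ≡ half
half-infects v (var p)  here      vp = vp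
half-infects v (¬' a)   (neg o)   vp rewrite half-infects v a o vp = refl
half-infects v (a ∧' b) (conjˡ o) vp rewrite half-infects v a o vp = refl
half-infects v (a ∧' b) (conjʳ o) vp rewrite half-infects v b o vp = andV-halfʳ (eval v a)

classical-or-infected : ∀ v a → Classical (eval v a) ⊎ ∃[ p ] (Occurs p a × v p ≡ half)
classical-or-infected v (var p) with v p in vp
... | one  = inj₁ (inj₁ refl)
... | half = inj₂ (p , here , vp)
... | zero = inj₁ (inj₂ refl)
classical-or-infected v (¬' a) with classical-or-infected v a
... | inj₁ c             = inj₁ (notV-classical c)
... | inj₂ (p , o , vp)  = inj₂ (p , neg o , vp)
classical-or-infected v (a ∧' b) with classical-or-infected v a | classical-or-infected v b
... | inj₂ (p , o , vp) | _                 = inj₂ (p , conjˡ o , vp)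
... | inj₁ _            | inj₂ (p , o , vp) = inj₂ (p , conjʳ o , vp)
... | inj₁ ca           | inj₁ cb           = inj₁ (andV-classical ca cb)

-- Key lemma for (⇒¬ᴮ): if var(a) ⊆ var(Γ) and all of Γ is true, then a
-- is classical, since a ½-valued variable of a would infect a member of Γ.
vars-in-true-context-classical : ∀ v {a Γ} → VarsIn a Γ → All (True v) Γ → Classical (eval v a)
vars-in-true-context-classical v {a} a⊆Γ Γ-true with classical-or-infected v a
... | inj₁ c            = c
... | inj₂ (p , o , vp) with a⊆Γ p o
...   | g , g∈Γ , og with trans (sym (half-infects v g og vp)) (All-lookup Γ-true g∈Γ)
...     | ()

sound : ∀ {Γ Δ} → ⊢B Γ Δ → ⊨B3 Γ Δ
sound (ax a) v (a-true ∷ _) = here a-true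
sound (set {Γ} {Δ} {Γ'} {Δ'} Γ≈Γ' Δ≈Δ' d) v Γ'-true =
  Any-resp-⊆ {x = Δ} {Δ'} (λ {a} → proj₁ (Δ≈Δ' a))
    (sound d v (All-resp-⊇ {x = Γ'} {Γ} (λ {a} → proj₁ (Γ≈Γ' a)) Γ'-true))
sound (wL a d) v (_ ∷ Γ-true) = sound d v Γ-true
sound (wR a d) v Γ-true = there (sound d v Γ-true)
sound (cut a d₁ d₂) v Γ-true with sound d₁ v Γ-true
... | here a-true = sound d₂ v (a-true ∷ Γ-true)
... | there Δ-ok  = Δ-ok
sound (negL {a = a} d) v (¬a-true ∷ Γ-true) with sound d v Γ-true
... | here a-true = ⊥-elim (notV-true⁻ (eval v a) ¬a-true a-true)
... | there Δ-ok  = Δ-ok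
sound (negRB a⊆Γ d) v Γ-true with vars-in-true-context-classical v a⊆Γ Γ-true
... | inj₁ a-true = there (sound d v (a-true ∷ Γ-true))
... | inj₂ a-zero = here (notV-true⁺ a-zero)
sound (conjL {a = a} {b} d) v (ab-true ∷ Γ-true) =
  let a-true , b-true = andV-true⁻ (eval v a) (eval v b) ab-true
  in sound d v (a-true ∷ b-true ∷ Γ-true)
sound (conjR d₁ d₂) v Γ-true with sound d₁ v Γ-true | sound d₂ v Γ-true
... | there Δ-ok  | _           = there Δ-ok
... | here _      | there Δ-ok  = there Δ-ok
... | here a-true | here b-true = here (andV-true⁺ a-true b-true)

mainTheorem4 : (∀ (Γ Δ : List Form) → NonEmptySeq Γ Δ → ⊢B Γ Δ → ⊨B3 Γ Δ)
    × (∀ (Γ : List Form) (a : Form) → ⊢B Γ (a ∷ []) → Conseq Γ a)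
mainTheorem4 = (λ Γ Δ _ d → sound d)
             , (λ Γ a d v Γ-true → singleton⁻ (sound d v Γ-true))
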